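{- Let $M$ be an arbitrary monoid with identity $1$, fix a well-ordering of $M$ whose least element is $1$, and let $\hat{\mathcal E}(\omega)$ be the ordered $M$-set whose underlying $M$-set is the cofree $M$-set $(\omega^M,\gamma)$, $\gamma(m,h)(m')=h(m\cdot m')$, ordered lexicographically. Then: (i) for every finite ordered $M$-set $\mathcal B$ there exists an embedding $\mathcal B\to\hat{\mathcal E}(\omega)$; and (ii) $\hat{\mathcal E}(\omega)$ is weakly locally finite for the class of finite ordered $M$-sets: for all finite ordered $M$-sets $\mathcal A,\mathcal B$ and all embeddings $e:\mathcal A\to\hat{\mathcal E}(\omega)$, $f:\mathcal B\to\hat{\mathcal E}(\omega)$ there exist a finite ordered $M$-set $\mathcal D$ and embeddings $r:\mathcal D\to\hat{\mathcal E}(\omega)$, $p:\mathcal A\to\mathcal D$, $q:\mathcal B\to\mathcal D$ with $r\cdot p=e$ and $r\cdot q=f$.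
   Context: An $M$-set is a pair $(A,\alpha)$ with $\alpha:M\times A\to A$ such that $\alpha(1,a)=a$ and $\alpha(m_1,\alpha(m_2,a))=\alpha(m_2\cdot m_1,a)$. An ordered $M$-set is an $M$-set with a linear order on its underlying set; an embedding of ordered $M$-sets is a strictly increasing map $f$ with $f(\alpha(m,a))=\beta(m,f(a))$. The lexicographic order on $\omega^M$ (w.r.t. the fixed well-order of $M$): $f<g$ iff $f(v)<g(v)$ for $v=\min\{w: f(w)\ne g(w)\}$. -}

module Defs where

open import Level using (0ℓ)
open import Data.Nat using (ℕ) renaming (_<_ to _<ℕ_)
open import Data.Fin using (Fin)
open import Data.Product using (Σ; ∃; _×_; _,_)
open import Relation.Binary.PropositionalEquality using (_≡_; _≢_)
open import Relation.Binary.Structures using (IsStrictTotalOrder)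
open import Algebra.Structures using (IsMonoid)
open import Induction.WellFounded using (WellFounded)
open import Data.Sum using (_⊎_)
open import Function.Bundles using (_↔_)

record WOMonoid : Set₁ where
  field
    Carrier  : Set
    _∙_      : Carrier → Carrier → Carrier
    ε        : Carrier
    isMonoid : IsMonoid _≡_ _∙_ ε
    _≺_      : Carrier → Carrier → Set
    isSTO    : IsStrictTotalOrder _≡_ _≺_
    wf       : WellFounded _≺_
    ε-least  : ∀ m → ε ≡ m ⊎ ε ≺ m

module Over (W : WOMonoid) where
  open WOMonoid W renaming (Carrier to M)

  record FinOrdMSet : Set₁ where
    field
      Carrier  : Set
      act      : M → Carrier → Carrier
      act-id   : ∀ a → act ε a ≡ a
      act-comp : ∀ m₁ m₂ a → act m₁ (act m₂ a) ≡ act (m₂ ∙ m₁) a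
      _<_      : Carrier → Carrier → Set
      isSTO    : IsStrictTotalOrder _≡_ _<_
      finite   : ∃ λ n → Carrier ↔ Fin n

  open FinOrdMSet

  ωᴹ : Set
  ωᴹ = M → ℕ

  _≐_ : ωᴹ → ωᴹ → Set
  h ≐ h' = ∀ m → h m ≡ h' m

  γ : M → ωᴹ → ωᴹ
  γ m h m' = h (m ∙ m')

  -- lexicographic order: f < g iff f(v) < g(v) at v = min{w : f(w) ≠ g(w)},
  -- i.e. at some v below which f and g agree.
  _<lex_ : ωᴹ → ωᴹ → Set
  f <lex g = ∃ λ v → (f v <ℕ g v) × (∀ w → w ≺ v → f w ≡ g w)

  record Emb (A B : FinOrdMSet) : Set where
    field
      fun    : Carrier A → Carrier B
      mono   : ∀ {a a'} → _<_ A a a' → _<_ B (fun a) (fun a')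
      equiv  : ∀ m a → fun (act A m a) ≡ act B m (fun a)
  open Emb public

  record EmbÊ (A : FinOrdMSet) : Set where
    field
      funÊ   : Carrier A → ωᴹ
      monoÊ  : ∀ {a a'} → _<_ A a a' → funÊ a <lex funÊ a'
      equivÊ : ∀ m a → funÊ (act A m a) ≐ γ m (funÊ a)
  open EmbÊ public

  Universal : Set₁
  Universal = (B : FinOrdMSet) → EmbÊ B

  WeaklyLocallyFinite : Set₁
  WeaklyLocallyFinite =
    (A B : FinOrdMSet) (e : EmbÊ A) (f : EmbÊ B) →
    Σ FinOrdMSet λ D → Σ (EmbÊ D) λ r → Σ (Emb A D) λ p → Σ (Emb B D) λ q →
      (∀ a → funÊ r (fun p a) ≐ funÊ e a) × (∀ b → funÊ r (fun q b) ≐ funÊ f b)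

{-# OPTIONS --safe #-}
-- (i) A finite ordered M-set B embeds by sending b to m ↦ rank of m·b in B: the
-- cofree action makes this equivariant, and since 1 is least in M the
-- lexicographic comparison of two such functions is decided at 1, i.e. by the
-- order of B itself.
-- (ii) Given e : A → Ê(ω) and f : B → Ê(ω), take for D the image of A ⊔ B under
-- [e, f]; as a sub-M-set of Ê(ω) with the induced order it is a finite ordered
-- M-set. It is realised as the set of chosen representatives of the fibres of
-- [e, f], a point of B being represented by the point of A with the same image if
-- there is one. Excluded middle is used to make this choice and to make the
-- lexicographic order total (via the least point of difference).
module Submission where

open import Level using (0ℓ)
open import Data.Bool using (Bool; true; false; T)
open import Data.Bool.Properties using (T-irrelevant)
open import Data.Fin using (Fin; zero; suc)
open import Data.Fin.Properties using (1↔⊤; +↔⊎)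
open import Data.List using (List; []; _∷_; filter; length; tabulate)
open import Data.List.Membership.Propositional using (_∈_)
open import Data.List.Membership.Propositional.Properties using (∈-tabulate⁺)
open import Data.List.Relation.Unary.Any using (here; there)
open import Data.Nat using (ℕ; zero; suc; z≤n; s≤s) renaming (_≤_ to _≤ℕ_; _<_ to _<ℕ_)
open import Data.Nat.Properties using (m≤n⇒m≤1+n; <-irrefl; <-trans; <-cmp; _≟_)
open import Data.Product using (Σ; ∃; _×_; _,_; proj₂)
open import Data.Product.Properties using (Σ-≡,≡→≡)
open import Data.Product.Function.Dependent.Propositional using (Σ-↔)
open import Data.Sum as Sum using (_⊎_; inj₁; inj₂; [_,_])
open import Data.Sum.Function.Propositional using (_⊎-↔_)
open import Data.Sum.Properties using (≡-dec)
open import Function using (_∘_; _on_; id)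
open import Function.Bundles using (_↔_; mk↔ₛ′; Inverse)
open import Function.Properties.Inverse using (↔-refl; ↔-sym; ↔-trans)
open import Induction.WellFounded using (WellFounded; Acc; acc)
open import Axiom.ExcludedMiddle using (ExcludedMiddle)
import Relation.Binary.Construct.On as On
open import Relation.Binary using (Rel; IsEquivalence; IsStrictTotalOrder; DecidableEquality)
open import Relation.Binary.Definitions
  using (Irreflexive; Transitive; Asymmetric; Trichotomous; Tri; tri<; tri≈; tri>)
open import Relation.Binary.PropositionalEquality as ≡ using (_≡_; _≢_; refl; cong; subst; subst₂)
open import Relation.Nullary using (¬_; yes; no; contradiction)
open import Relation.Nullary.Decidable using (Dec; ⌊_⌋; decidable-stable; fromWitness; toWitness)
open import Defs

Σ-Fin-suc-↔ : ∀ {n} {P : Fin (suc n) → Set} → Σ (Fin (suc n)) P ↔ (P zero ⊎ Σ (Fin n) (P ∘ suc))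
Σ-Fin-suc-↔ = mk↔ₛ′
  (λ { (zero , p) → inj₁ p ; (suc i , p) → inj₂ (i , p) })
  (λ { (inj₁ p) → zero , p ; (inj₂ (i , p)) → suc i , p })
  (λ { (inj₁ _) → refl ; (inj₂ _) → refl })
  (λ { (zero , _) → refl ; (suc _ , _) → refl })

T⊎-finite : ∀ b {A : Set} {k} → A ↔ Fin k → ∃ λ k′ → (T b ⊎ A) ↔ Fin k′
T⊎-finite true  φ = _ , ↔-trans (↔-sym 1↔⊤ ⊎-↔ φ) (↔-sym +↔⊎)
T⊎-finite false φ =
  _ , ↔-trans (mk↔ₛ′ [ (λ ()) , id ] inj₂ (λ _ → refl) (λ { (inj₁ ()) ; (inj₂ _) → refl })) φ

Σ-Fin-T-finite : ∀ n (P : Fin n → Bool) → ∃ λ k → Σ (Fin n) (T ∘ P) ↔ Fin k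
Σ-Fin-T-finite zero    P = 0 , mk↔ₛ′ (λ { (() , _) }) (λ ()) (λ ()) (λ { (() , _) })
Σ-Fin-T-finite (suc n) P with Σ-Fin-T-finite n (P ∘ suc)
... | k , φ with T⊎-finite (P zero) φ
...   | k′ , ψ = k′ , ↔-trans Σ-Fin-suc-↔ ψ

Σ-T-finite : ∀ {X : Set} {n} → X ↔ Fin n → (P : X → Bool) → ∃ λ k → Σ X (T ∘ P) ↔ Fin k
Σ-T-finite {n = n} φ P with Σ-Fin-T-finite n (P ∘ Inverse.from φ)
... | k , ψ = k , ↔-trans (↔-sym (Σ-↔ (↔-sym φ) ↔-refl)) ψ

Σ-T-≡ : ∀ {X : Set} {P : X → Bool} {x y} {s : T (P x)} {t : T (P y)} →
        x ≡ y → _≡_ {A = Σ X (T ∘ P)} (x , s) (y , t)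
Σ-T-≡ refl = Σ-≡,≡→≡ (refl , T-irrelevant _ _)

wf-minimal : ∀ {A : Set} {_≺_ : Rel A 0ℓ} → ExcludedMiddle 0ℓ → WellFounded _≺_ →
             (P : A → Set) → ∀ {w} → P w → ∃ λ v → P v × (∀ u → u ≺ v → ¬ P u)
wf-minimal {_≺_ = _≺_} em wf P {w} = go w (wf w)
  where
  go : ∀ w → Acc _≺_ w → P w → ∃ λ v → P v × (∀ u → u ≺ v → ¬ P u)
  go w (acc rs) Pw with em {∃ λ u → u ≺ w × P u}
  ... | yes (u , u≺w , Pu) = go u (rs u≺w) Pu
  ... | no  ¬smaller       = w , Pw , λ u u≺w Pu → ¬smaller (u , u≺w , Pu)

isStrictTotalOrder-≡ : ∀ {A : Set} {_≈_ _<_ : Rel A 0ℓ} → (∀ {x y} → x ≈ y → x ≡ y) →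
                       IsStrictTotalOrder _≈_ _<_ → IsStrictTotalOrder _≡_ _<_
isStrictTotalOrder-≡ {_<_ = _<_} ≈⇒≡ sto = record
  { isStrictPartialOrder = record
    { isEquivalence = ≡.isEquivalence
    ; irrefl        = λ { refl → irrefl Eq.refl }
    ; trans         = trans
    ; <-resp-≈      = (λ { refl x<y → x<y }) , (λ { refl x<y → x<y })
    }
  ; compare = compare′
  }
  where
  open IsStrictTotalOrder sto
  compare′ : ∀ x y → Tri (x < y) (x ≡ y) (y < x)
  compare′ x y with compare x y
  ... | tri< x<y x≉y y≮x = tri< x<y (λ { refl → x≉y Eq.refl }) y≮x
  ... | tri≈ x≮y x≈y y≮x = tri≈ x≮y (≈⇒≡ x≈y) y≮x
  ... | tri> x≮y x≉y y<x = tri> x≮y (λ { refl → x≉y Eq.refl }) y<x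

module Rank {X : Set} {_<_ : Rel X 0ℓ} (sto : IsStrictTotalOrder _≡_ _<_) where
  open IsStrictTotalOrder sto

  rank : List X → X → ℕ
  rank xs x = length (filter (_<? x) xs)

  rank-mono-≤ : ∀ {x y} → x < y → ∀ xs → rank xs x ≤ℕ rank xs y
  rank-mono-≤ x<y [] = z≤n
  rank-mono-≤ {x} {y} x<y (z ∷ zs) with z <? x | z <? y
  ... | yes _   | yes _   = s≤s (rank-mono-≤ x<y zs)
  ... | yes z<x | no  z≮y = contradiction (trans z<x x<y) z≮y
  ... | no  _   | yes _   = m≤n⇒m≤1+n (rank-mono-≤ x<y zs)
  ... | no  _   | no  _   = rank-mono-≤ x<y zs

  rank-mono-< : ∀ {x y xs} → x < y → x ∈ xs → rank xs x <ℕ rank xs y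
  rank-mono-< {x} {y} {_ ∷ zs} x<y (here refl) with x <? x | x <? y
  ... | yes x<x | _       = contradiction x<x (irrefl refl)
  ... | no  _   | yes _   = s≤s (rank-mono-≤ x<y zs)
  ... | no  _   | no  x≮y = contradiction x<y x≮y
  rank-mono-< {x} {y} {z ∷ zs} x<y (there x∈zs) with z <? x | z <? y
  ... | yes _   | yes _   = s≤s (rank-mono-< x<y x∈zs)
  ... | yes z<x | no  z≮y = contradiction (trans z<x x<y) z≮y
  ... | no  _   | yes _   = m≤n⇒m≤1+n (rank-mono-< x<y x∈zs)
  ... | no  _   | no  _   = rank-mono-< x<y x∈zs

module Cofree (W : WOMonoid) where
  open WOMonoid W using (_∙_; ε; _≺_; wf; ε-least) renaming (Carrier to M)
  private module ≺ = IsStrictTotalOrder (WOMonoid.isSTO W)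
  open Over W
  open FinOrdMSet

  ≐-isEquivalence : IsEquivalence _≐_
  ≐-isEquivalence = record
    { refl  = λ _ → refl
    ; sym   = λ f≐g m → ≡.sym (f≐g m)
    ; trans = λ f≐g g≐h m → ≡.trans (f≐g m) (g≐h m)
    }

  private module ≐ = IsEquivalence ≐-isEquivalence

  <lex-irrefl : Irreflexive _≐_ _<lex_
  <lex-irrefl f≐g (v , fv<gv , _) = <-irrefl (f≐g v) fv<gv

  <lex-trans : Transitive _<lex_
  <lex-trans {f} {g} {h} (v , fv<gv , f=g) (v′ , gv′<hv′ , g=h) with ≺.compare v v′
  ... | tri< v≺v′ _ _ = v , subst (f v <ℕ_) (g=h v v≺v′) fv<gv
                          , λ w w≺v → ≡.trans (f=g w w≺v) (g=h w (≺.trans w≺v v≺v′))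
  ... | tri≈ _ refl _ = v , <-trans fv<gv gv′<hv′ , λ w w≺v → ≡.trans (f=g w w≺v) (g=h w w≺v)
  ... | tri> _ _ v′≺v = v′ , subst (_<ℕ h v′) (≡.sym (f=g v′ v′≺v)) gv′<hv′
                          , λ w w≺v′ → ≡.trans (f=g w (≺.trans w≺v′ v′≺v)) (g=h w w≺v′)

  <lex-resp : ∀ {f f′ g g′} → f ≐ f′ → g ≐ g′ → f <lex g → f′ <lex g′
  <lex-resp f≐f′ g≐g′ (v , fv<gv , f=g) =
    v , subst₂ _<ℕ_ (f≐f′ v) (g≐g′ v) fv<gv
      , λ w w≺v → ≡.trans (≡.sym (f≐f′ w)) (≡.trans (f=g w w≺v) (g≐g′ w))

  <lex-asym : Asymmetric _<lex_
  <lex-asym f<g g<f = <lex-irrefl ≐.refl (<lex-trans f<g g<f)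

  ε-minimal : ∀ w → ¬ w ≺ ε
  ε-minimal w w≺ε with ε-least w
  ... | inj₁ refl = ≺.irrefl refl w≺ε
  ... | inj₂ ε≺w  = ≺.asym w≺ε ε≺w

  <lex-at-ε : ∀ {f g} → f ε <ℕ g ε → f <lex g
  <lex-at-ε fε<gε = ε , fε<gε , λ w w≺ε → contradiction w≺ε (ε-minimal w)

  funÊ-injective : ∀ {A} (E : EmbÊ A) {a a′} → funÊ E a ≐ funÊ E a′ → a ≡ a′
  funÊ-injective {A} E {a} {a′} Ea≐Ea′ with IsStrictTotalOrder.compare (isSTO A) a a′
  ... | tri< a<a′ _ _ = contradiction (monoÊ E a<a′) (<lex-irrefl Ea≐Ea′)
  ... | tri≈ _ a≡a′ _ = a≡a′
  ... | tri> _ _ a′<a = contradiction (monoÊ E a′<a) (<lex-irrefl (≐.sym Ea≐Ea′))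

  cofreeEmb : (A : FinOrdMSet) (ρ : Carrier A → ℕ) →
              (∀ {a a′} → _<_ A a a′ → ρ a <ℕ ρ a′) → EmbÊ A
  cofreeEmb A ρ ρ-mono = record
    { funÊ   = λ a m → ρ (act A m a)
    ; monoÊ  = λ {a} {a′} a<a′ → <lex-at-ε (subst₂ _<ℕ_ (cong ρ (≡.sym (act-id A a)))
                                                        (cong ρ (≡.sym (act-id A a′))) (ρ-mono a<a′))
    ; equivÊ = λ m a m′ → cong ρ (act-comp A m′ m a)
    }

  universal : Universal
  universal B = cofreeEmb B (rank elements) (λ b<b′ → rank-mono-< b<b′ (enumerates _))
    where
    open Rank (isSTO B)
    module φ = Inverse (proj₂ (finite B))
    elements : List (Carrier B)
    elements = tabulate φ.from
    enumerates : ∀ b → b ∈ elements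
    enumerates b = subst (_∈ elements) (φ.strictlyInverseʳ b) (∈-tabulate⁺ (φ.to b))

  record MSet : Set₁ where
    field
      Carrier  : Set
      act      : M → Carrier → Carrier
      act-id   : ∀ x → act ε x ≡ x
      act-comp : ∀ m₁ m₂ x → act m₁ (act m₂ x) ≡ act (m₂ ∙ m₁) x

  _⊎ᴹ_ : FinOrdMSet → FinOrdMSet → MSet
  A ⊎ᴹ B = record
    { Carrier  = Carrier A ⊎ Carrier B
    ; act      = λ m → Sum.map (act A m) (act B m)
    ; act-id   = [ cong inj₁ ∘ act-id A , cong inj₂ ∘ act-id B ]
    ; act-comp = λ m₁ m₂ → [ cong inj₁ ∘ act-comp A m₁ m₂ , cong inj₂ ∘ act-comp B m₁ m₂ ]
    }

  record Representatives {X : Set} (ρ : X → ωᴹ) : Set where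
    field
      rep     : X → X
      rep-≐   : ∀ x → ρ (rep x) ≐ ρ x
      ≐⇒rep-≡ : ∀ {x y} → ρ x ≐ ρ y → rep x ≡ rep y

    rep-idem : ∀ x → rep (rep x) ≡ rep x
    rep-idem x = ≐⇒rep-≡ (rep-≐ x)

  module Classical (em : ExcludedMiddle 0ℓ) where

    first-difference : ∀ f g → ¬ f ≐ g → ∃ λ v → f v ≢ g v × (∀ w → w ≺ v → f w ≡ g w)
    first-difference f g f≉g with em {∃ λ w → f w ≢ g w}
    ... | no  none =
      contradiction (λ m → decidable-stable (f m ≟ g m) (λ fm≢gm → none (m , fm≢gm))) f≉g
    ... | yes (_ , fw≢gw) with wf-minimal em wf (λ w → f w ≢ g w) fw≢gw
    ...   | v , fv≢gv , minimal =
      v , fv≢gv , λ w w≺v → decidable-stable (f w ≟ g w) (minimal w w≺v)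

    <lex-compare : Trichotomous _≐_ _<lex_
    <lex-compare f g with em {f ≐ g}
    ... | yes f≐g = tri≈ (<lex-irrefl f≐g) f≐g (<lex-irrefl (≐.sym f≐g))
    ... | no  f≉g with first-difference f g f≉g
    ...   | v , fv≢gv , agree with <-cmp (f v) (g v)
    ...     | tri< fv<gv _ _ = tri< f<g f≉g (<lex-asym f<g)
      where f<g = v , fv<gv , agree
    ...     | tri≈ _ fv≡gv _ = contradiction fv≡gv fv≢gv
    ...     | tri> _ _ gv<fv = tri> (<lex-asym g<f) f≉g g<f
      where g<f = v , gv<fv , λ w w≺v → ≡.sym (agree w w≺v)

    <lex-isStrictTotalOrder : IsStrictTotalOrder _≐_ _<lex_
    <lex-isStrictTotalOrder = record
      { isStrictPartialOrder = record
        { isEquivalence = ≐-isEquivalence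
        ; irrefl        = <lex-irrefl
        ; trans         = <lex-trans
        ; <-resp-≈      = (λ g≐g′ → <lex-resp ≐.refl g≐g′) , (λ f≐f′ → <lex-resp f≐f′ ≐.refl)
        }
      ; compare = <lex-compare
      }

    module Image (X : MSet) (_≟X_ : DecidableEquality (MSet.Carrier X))
                 {n} (enum : MSet.Carrier X ↔ Fin n) (ρ : MSet.Carrier X → ωᴹ)
                 (ρ-equiv : ∀ m x → ρ (MSet.act X m x) ≐ γ m (ρ x)) (reps : Representatives ρ) where
      open MSet X using ()
        renaming (Carrier to Elt; act to actX; act-id to actX-id; act-comp to actX-comp)
      open Representatives reps

      rep-act : ∀ m x → rep (actX m (rep x)) ≡ rep (actX m x)
      rep-act m x = ≐⇒rep-≡ λ k → begin
        ρ (actX m (rep x)) k  ≡⟨ ρ-equiv m (rep x) k ⟩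
        ρ (rep x) (m ∙ k)     ≡⟨ rep-≐ x (m ∙ k) ⟩
        ρ x (m ∙ k)           ≡⟨ ≡.sym (ρ-equiv m x k) ⟩
        ρ (actX m x) k        ∎
        where open ≡.≡-Reasoning

      isRep : Elt → Bool
      isRep x = ⌊ rep x ≟X x ⌋

      Rep : Set
      Rep = Σ Elt (T ∘ isRep)

      Rep-≡ : ∀ {x y} {s : T (isRep x)} {t : T (isRep y)} → x ≡ y → _≡_ {A = Rep} (x , s) (y , t)
      Rep-≡ = Σ-T-≡

      ι : Elt → Rep
      ι x = rep x , fromWitness (rep-idem x)

      ρ̂ : Rep → ωᴹ
      ρ̂ (x , _) = ρ x

      ρ̂-ι : ∀ x → ρ̂ (ι x) ≐ ρ x
      ρ̂-ι = rep-≐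

      ρ̂-injective : ∀ {u v} → ρ̂ u ≐ ρ̂ v → u ≡ v
      ρ̂-injective {x , s} {y , t} ρx≐ρy = Rep-≡ (begin
        x      ≡⟨ toWitness s ⟨
        rep x  ≡⟨ ≐⇒rep-≡ ρx≐ρy ⟩
        rep y  ≡⟨ toWitness t ⟩
        y      ∎)
        where open ≡.≡-Reasoning

      D : FinOrdMSet
      D = record
        { Carrier  = Rep
        ; act      = λ m (x , _) → ι (actX m x)
        ; act-id   = λ (x , t) → Rep-≡ (≡.trans (cong rep (actX-id x)) (toWitness t))
        ; act-comp = λ m₁ m₂ (x , _) →
                       Rep-≡ (≡.trans (rep-act m₁ (actX m₂ x)) (cong rep (actX-comp m₁ m₂ x)))
        ; _<_      = _<lex_ on ρ̂
        ; isSTO    = isStrictTotalOrder-≡ ρ̂-injective (On.isStrictTotalOrder ρ̂ <lex-isStrictTotalOrder)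
        ; finite   = Σ-T-finite enum isRep
        }

      ρ̂-embedding : EmbÊ D
      ρ̂-embedding = record
        { funÊ   = ρ̂
        ; monoÊ  = id
        ; equivÊ = λ m (x , _) k → ≡.trans (ρ̂-ι (actX m x) k) (ρ-equiv m x k)
        }

      module Factor {A : FinOrdMSet} (E : EmbÊ A) (g : Carrier A → Elt)
                    (g-equiv : ∀ m a → g (act A m a) ≡ actX m (g a))
                    (ρg≐E : ∀ a → ρ (g a) ≐ funÊ E a) where

        factor-commutes : ∀ a → ρ̂ (ι (g a)) ≐ funÊ E a
        factor-commutes a k = ≡.trans (ρ̂-ι (g a) k) (ρg≐E a k)

        factor : Emb A D
        factor = record
          { fun   = ι ∘ g
          ; mono  = λ a<a′ →
                      <lex-resp (≐.sym (factor-commutes _)) (≐.sym (factor-commutes _)) (monoÊ E a<a′)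
          ; equiv = λ m a → Rep-≡ (≡.trans (cong rep (g-equiv m a)) (≡.sym (rep-act m (g a))))
          }

    coproduct-representatives : ∀ {A B} (e : EmbÊ A) (f : EmbÊ B) →
                                Representatives [ funÊ e , funÊ f ]
    coproduct-representatives {A} {B} e f =
      record { rep = rep ; rep-≐ = rep-≐ ; ≐⇒rep-≡ = λ {x} {y} → ≐⇒rep-≡ {x} {y} }
      where
      ρ : Carrier A ⊎ Carrier B → ωᴹ
      ρ = [ funÊ e , funÊ f ]

      Matched : Carrier B → Set
      Matched b = Σ (Carrier A) λ a → funÊ e a ≐ funÊ f b

      choose : ∀ b → Dec (Matched b) → Carrier A ⊎ Carrier B
      choose b (yes (a , _)) = inj₁ a
      choose b (no  _)       = inj₂ b

      choose-≐ : ∀ b m? → ρ (choose b m?) ≐ funÊ f b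
      choose-≐ b (yes (_ , ea≐fb)) = ea≐fb
      choose-≐ b (no  _)           = ≐.refl

      choose-matched : ∀ a b m? → funÊ e a ≐ funÊ f b → inj₁ a ≡ choose b m?
      choose-matched a b (yes (a′ , ea′≐fb)) ea≐fb =
        cong inj₁ (funÊ-injective e (≐.trans ea≐fb (≐.sym ea′≐fb)))
      choose-matched a b (no  unmatched)     ea≐fb = contradiction (a , ea≐fb) unmatched

      rep : Carrier A ⊎ Carrier B → Carrier A ⊎ Carrier B
      rep (inj₁ a) = inj₁ a
      rep (inj₂ b) = choose b em

      rep-≐ : ∀ x → ρ (rep x) ≐ ρ x
      rep-≐ (inj₁ a) = ≐.refl
      rep-≐ (inj₂ b) = choose-≐ b em

      ≐⇒rep-≡ : ∀ {x y} → ρ x ≐ ρ y → rep x ≡ rep y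
      ≐⇒rep-≡ {inj₁ a} {inj₁ a′} ea≐ea′ = cong inj₁ (funÊ-injective e ea≐ea′)
      ≐⇒rep-≡ {inj₁ a} {inj₂ b}  ea≐fb  = choose-matched a b em ea≐fb
      ≐⇒rep-≡ {inj₂ b} {inj₁ a}  fb≐ea  = ≡.sym (choose-matched a b em (≐.sym fb≐ea))
      ≐⇒rep-≡ {inj₂ b} {inj₂ b′} fb≐fb′ = cong (λ b → choose b em) (funÊ-injective f fb≐fb′)

    weaklyLocallyFinite : WeaklyLocallyFinite
    weaklyLocallyFinite A B e f =
      D , ρ̂-embedding , p.factor , q.factor , p.factor-commutes , q.factor-commutes
      where
      open Image (A ⊎ᴹ B) (≡-dec (IsStrictTotalOrder._≟_ (isSTO A)) (IsStrictTotalOrder._≟_ (isSTO B)))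
                 (↔-trans (proj₂ (finite A) ⊎-↔ proj₂ (finite B)) (↔-sym +↔⊎))
                 [ funÊ e , funÊ f ] (λ m → [ equivÊ e m , equivÊ f m ]) (coproduct-representatives e f)
      module p = Factor e inj₁ (λ _ _ → refl) (λ _ → ≐.refl)
      module q = Factor f inj₂ (λ _ _ → refl) (λ _ → ≐.refl)

lemma4p3 : ExcludedMiddle 0ℓ → (W : WOMonoid) → Over.Universal W × Over.WeaklyLocallyFinite W
lemma4p3 em W = Cofree.universal W , Cofree.Classical.weaklyLocallyFinite W em
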